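{- Let $q$ be any positive integer. For any set of consumers $\mathcal{C}$ and any partition $\mathcal{I}=\bigcup_{j=1}^q\mathcal{I}_j$ of the item set, under the UDP (resp. SMP) buying rule, $\mathrm{OPT}(\mathcal{C},\mathcal{I})\le\sum_{j=1}^q\mathrm{OPT}(\mathcal{C},\mathcal{I}_j)$.
   Context: A pricing instance $(\mathcal{C},\mathcal{I})$ consists of a set $\mathcal{I}$ of items and a set $\mathcal{C}$ of consumers; each consumer $c$ has a budget $B_c\ge0$ and a set $S_c\subseteq\mathcal{I}$. The instance $(\mathcal{C},\mathcal{I}_j)$ has the same consumers and budgets with desired sets $S_c\cap\mathcal{I}_j$. Given prices $p$, under UDP consumer $c$ pays $\min_{i\in S_c}p(i)$ if this is at most $B_c$ and $0$ otherwise; under SMP, $c$ pays $\sum_{i\in S_c}p(i)$ if this is at most $B_c$ and $0$ otherwise. $\mathrm{OPT}(\cdot,\cdot)$ is the maximum total revenue over all price functions.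
   Formalization: The budgets $B_c$ and the price functions take rational values rather than real ones. -}

module Defs where

open import Data.Nat using (ℕ; zero; suc)
open import Data.Bool using (Bool; true; false; if_then_else_)
open import Data.Fin using (Fin; zero; suc)
open import Data.Fin.Properties using () renaming (_≟_ to _≟ᶠ_)
open import Data.Fin.Subset using (Subset; _∩_)
open import Data.Vec using (Vec; []; _∷_; tabulate)
open import Data.List using (List; []; _∷_; map)
open import Data.Maybe using (Maybe; just; nothing)
open import Data.Product using (Σ; _×_; _,_; proj₁; proj₂)
open import Data.Rational using (ℚ; 0ℚ; _+_; _⊓_; _≤_)
open import Data.Rational.Properties using (_≤?_)
open import Relation.Nullary using (does)
open import Relation.Binary.PropositionalEquality using (_≡_)

data Rule : Set where
  UDP SMP : Rule

Consumer : ℕ → Set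
Consumer n = ℚ × Subset n

budget : ∀ {n} → Consumer n → ℚ
budget = proj₁

desired : ∀ {n} → Consumer n → Subset n
desired = proj₂

Prices : ℕ → Set
Prices n = Fin n → ℚ

NonNegPrices : ∀ {n} → Prices n → Set
NonNegPrices p = ∀ i → 0ℚ ≤ p i

sumOver : ∀ {n} → Prices n → Subset n → ℚ
sumOver {zero} p [] = 0ℚ
sumOver {suc n} p (b ∷ S) = (if b then p zero else 0ℚ) + sumOver (λ i → p (suc i)) S

-- min_{i ∈ S} p(i), or nothing if S is empty (min over ∅ = +∞)
minOver : ∀ {n} → Prices n → Subset n → Maybe ℚ
minOver {zero} p [] = nothing
minOver {suc n} p (b ∷ S) with minOver (λ i → p (suc i)) S
... | nothing = if b then just (p zero) else nothing
... | just m  = just (if b then p zero ⊓ m else m)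

payIfAffordable : ℚ → ℚ → ℚ
payIfAffordable B x = if does (x ≤? B) then x else 0ℚ

payment : ∀ {n} → Rule → Prices n → Consumer n → ℚ
payment UDP p c with minOver p (desired c)
... | nothing = 0ℚ
... | just m  = payIfAffordable (budget c) m
payment SMP p c = payIfAffordable (budget c) (sumOver p (desired c))

sumList : List ℚ → ℚ
sumList [] = 0ℚ
sumList (x ∷ xs) = x + sumList xs

revenue : ∀ {n} → Rule → Prices n → List (Consumer n) → ℚ
revenue r p C = sumList (map (payment r p) C)

IsOPT : ∀ {n} → Rule → List (Consumer n) → ℚ → Set
IsOPT {n} r C opt =
  (Σ (Prices n) λ p → NonNegPrices p × revenue r p C ≡ opt) ×
  (∀ (p : Prices n) → NonNegPrices p → revenue r p C ≤ opt)

-- Partition of the items into q blocks, given by the block index of each item.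
block : ∀ {n q} → (Fin n → Fin q) → Fin q → Subset n
block part j = tabulate (λ i → does (part i ≟ᶠ j))

-- The instance (C, I_j): same consumers and budgets, desired sets S_c ∩ I_j.
restrict : ∀ {n q} → (Fin n → Fin q) → Fin q → List (Consumer n) → List (Consumer n)
restrict part j = map (λ c → budget c , desired c ∩ block part j)

sumFin : ∀ {q} → (Fin q → ℚ) → ℚ
sumFin {zero} f = 0ℚ
sumFin {suc q} f = f zero + sumFin (λ j → f (suc j))

-- Fix prices p that are optimal for (C, I). Each consumer pays, under p, at most the sum of
-- what it pays in the q restricted instances: under SMP its sum splits over the blocks and
-- every block sum is affordable once the total is; under UDP the cheapest desired item lies in
-- one block, where the consumer sees the same minimum. Summing over consumers, OPT(C, I) is
-- at most the sum of the revenues of p on the instances (C, I_j), each bounded by OPT(C, I_j).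
module Submission where

open import Defs
open import Data.Nat using (ℕ; zero; suc)
open import Data.Fin using (Fin)
open import Data.List using (List)
open import Data.List.Relation.Unary.All using (All)
open import Data.Rational using (ℚ; 0ℚ; _≤_)
open import Data.Nat using () renaming (_≤_ to _≤ℕ_)

open import Algebra.Bundles using (CommutativeMonoid)
open import Data.Bool using (true; false; if_then_else_; _∧_)
open import Data.Fin using (zero; suc)
open import Data.Fin.Properties using () renaming (_≟_ to _≟ᶠ_)
open import Data.Fin.Subset using (Subset; _∩_; _∈_; _⊆_)
open import Data.Fin.Subset.Properties using (p∩q⊆p; x∈p∩q⁺)
open import Data.List using ([]; _∷_)
open import Data.Maybe using (just; nothing)
open import Data.Product using (Σ; _×_; _,_; proj₂)
open import Data.Sum using (inj₁; inj₂)
open import Data.Rational using (_+_)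
open import Data.Rational.Properties
  using (≤-refl; ≤-reflexive; ≤-trans; ≤-antisym; +-mono-≤; +-identityˡ; +-identityʳ;
         ⊓-sel; p⊓q≤p; p⊓q≤q; _≤?_; +-0-commutativeMonoid; module ≤-Reasoning)
open import Data.Vec using ([]; _∷_; here; there)
open import Data.Vec.Properties using (lookup⇒[]=; lookup∘tabulate)
open import Function using (_∘_)
open import Relation.Nullary using (Dec; yes; no; does)
open import Relation.Nullary.Decidable using (dec-true)
open import Relation.Binary.PropositionalEquality using (_≡_; refl; sym; trans; cong; cong₂; subst)

open import Algebra.Properties.CommutativeSemigroup
  (CommutativeMonoid.commutativeSemigroup +-0-commutativeMonoid) using (interchange)

private
  variable
    n q : ℕ

0≤0+0 : 0ℚ ≤ 0ℚ + 0ℚ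
0≤0+0 = ≤-reflexive (sym (+-identityʳ 0ℚ))

sumFin-cong : (f g : Fin q → ℚ) → (∀ j → f j ≡ g j) → sumFin f ≡ sumFin g
sumFin-cong {zero}  f g f≡g = refl
sumFin-cong {suc q} f g f≡g = cong₂ _+_ (f≡g zero) (sumFin-cong (f ∘ suc) (g ∘ suc) (f≡g ∘ suc))

sumFin-zero : (f : Fin q → ℚ) → (∀ j → f j ≡ 0ℚ) → sumFin f ≡ 0ℚ
sumFin-zero {zero}  f f≡0 = refl
sumFin-zero {suc q} f f≡0 =
  trans (cong₂ _+_ (f≡0 zero) (sumFin-zero (f ∘ suc) (f≡0 ∘ suc))) (+-identityʳ 0ℚ)

sumFin-mono-≤ : (f g : Fin q → ℚ) → (∀ j → f j ≤ g j) → sumFin f ≤ sumFin g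
sumFin-mono-≤ {zero}  f g f≤g = ≤-refl
sumFin-mono-≤ {suc q} f g f≤g = +-mono-≤ (f≤g zero) (sumFin-mono-≤ (f ∘ suc) (g ∘ suc) (f≤g ∘ suc))

sumFin-nonNeg : (f : Fin q → ℚ) → (∀ j → 0ℚ ≤ f j) → 0ℚ ≤ sumFin f
sumFin-nonNeg {zero}  f 0≤f = ≤-refl
sumFin-nonNeg {suc q} f 0≤f = ≤-trans 0≤0+0 (+-mono-≤ (0≤f zero) (sumFin-nonNeg (f ∘ suc) (0≤f ∘ suc)))

≤-sumFin : (f : Fin q → ℚ) → (∀ j → 0ℚ ≤ f j) → ∀ k → f k ≤ sumFin f
≤-sumFin {suc q} f 0≤f zero =
  ≤-trans (≤-reflexive (sym (+-identityʳ (f zero))))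
          (+-mono-≤ (≤-refl {f zero}) (sumFin-nonNeg (f ∘ suc) (0≤f ∘ suc)))
≤-sumFin {suc q} f 0≤f (suc k) =
  ≤-trans (≤-sumFin (f ∘ suc) (0≤f ∘ suc) k)
          (≤-trans (≤-reflexive (sym (+-identityˡ _))) (+-mono-≤ (0≤f zero) ≤-refl))

sumFin-+ : (f g : Fin q → ℚ) → sumFin (λ j → f j + g j) ≡ sumFin f + sumFin g
sumFin-+ {zero}  f g = sym (+-identityʳ 0ℚ)
sumFin-+ {suc q} f g =
  trans (cong (f zero + g zero +_) (sumFin-+ (f ∘ suc) (g ∘ suc)))
        (interchange (f zero) (g zero) (sumFin (f ∘ suc)) (sumFin (g ∘ suc)))

sumFin-indicator : (k : Fin q) (x : ℚ) → sumFin (λ j → if does (k ≟ᶠ j) then x else 0ℚ) ≡ x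
sumFin-indicator {suc q} zero x =
  trans (cong (x +_) (sumFin-zero {q} (λ _ → 0ℚ) (λ _ → refl))) (+-identityʳ x)
sumFin-indicator {suc q} (suc k) x =
  trans (cong (0ℚ +_) (sumFin-indicator k x)) (+-identityˡ x)

∈-block : (part : Fin n → Fin q) (i : Fin n) → i ∈ block part (part i)
∈-block part i =
  lookup⇒[]= i (block part (part i))
    (trans (lookup∘tabulate (λ i′ → does (part i′ ≟ᶠ part i)) i) (dec-true (part i ≟ᶠ part i) refl))

sumOver-nonNeg : (p : Prices n) → NonNegPrices p → ∀ S → 0ℚ ≤ sumOver p S
sumOver-nonNeg {zero}  p 0≤p []      = ≤-refl
sumOver-nonNeg {suc n} p 0≤p (b ∷ S) =
  ≤-trans 0≤0+0 (+-mono-≤ (head b) (sumOver-nonNeg (p ∘ suc) (0≤p ∘ suc) S))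
  where
  head : ∀ b → 0ℚ ≤ (if b then p zero else 0ℚ)
  head true  = 0≤p zero
  head false = ≤-refl

sumOver-∩-≤ : (p : Prices n) → NonNegPrices p → ∀ S T → sumOver p (S ∩ T) ≤ sumOver p S
sumOver-∩-≤ {zero}  p 0≤p []      []      = ≤-refl
sumOver-∩-≤ {suc n} p 0≤p (b ∷ S) (c ∷ T) =
  +-mono-≤ (head b c) (sumOver-∩-≤ (p ∘ suc) (0≤p ∘ suc) S T)
  where
  head : ∀ b c → (if b ∧ c then p zero else 0ℚ) ≤ (if b then p zero else 0ℚ)
  head true  true  = ≤-refl
  head true  false = 0≤p zero
  head false c     = ≤-refl

sumOver-partition : (p : Prices n) (part : Fin n → Fin q) (S : Subset n) →
  sumOver p S ≡ sumFin (λ j → sumOver p (S ∩ block part j))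
sumOver-partition {zero}  {q} p part [] = sym (sumFin-zero {q} _ (λ _ → refl))
sumOver-partition {suc n} {q} p part (b ∷ S) = sym (trans
  (sumFin-+ (λ j → if b ∧ does (part zero ≟ᶠ j) then p zero else 0ℚ)
            (λ j → sumOver (p ∘ suc) (S ∩ block (part ∘ suc) j)))
  (cong₂ _+_ (head b) (sym (sumOver-partition (p ∘ suc) (part ∘ suc) S))))
  where
  head : ∀ b → sumFin (λ j → if b ∧ does (part zero ≟ᶠ j) then p zero else 0ℚ)
             ≡ (if b then p zero else 0ℚ)
  head true  = sumFin-indicator (part zero) (p zero)
  head false = sumFin-zero {q} _ (λ _ → refl)

minOver-isJust : (p : Prices n) (S : Subset n) {i : Fin n} → i ∈ S → Σ ℚ λ m → minOver p S ≡ just m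
minOver-isJust {suc n} p (b ∷ S) i∈S with minOver (p ∘ suc) S in eq | i∈S
... | just _  | _         = _ , refl
... | nothing | here      = p zero , refl
... | nothing | there i∈T with minOver-isJust (p ∘ suc) S i∈T
...   | _ , eq′ with () ← trans (sym eq) eq′

minOver-attained : (p : Prices n) (S : Subset n) {m : ℚ} → minOver p S ≡ just m →
  Σ (Fin n) λ i → i ∈ S × p i ≡ m
minOver-attained {suc n} p (b ∷ S) min≡m with minOver (p ∘ suc) S in eq
minOver-attained p (true  ∷ S) refl | nothing = zero , here , refl
minOver-attained p (false ∷ S) ()   | nothing
minOver-attained p (false ∷ S) refl | just m′ with minOver-attained (p ∘ suc) S eq
... | i , i∈S , pi≡m′ = suc i , there i∈S , pi≡m′
minOver-attained p (true  ∷ S) refl | just m′ with ⊓-sel (p zero) m′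
... | inj₁ p0⊓m′≡p0 = zero , here , sym p0⊓m′≡p0
... | inj₂ p0⊓m′≡m′ with minOver-attained (p ∘ suc) S eq
...   | i , i∈S , pi≡m′ = suc i , there i∈S , trans pi≡m′ (sym p0⊓m′≡m′)

minOver-≤ : (p : Prices n) (S : Subset n) {m : ℚ} → minOver p S ≡ just m →
  ∀ {i} → i ∈ S → m ≤ p i
minOver-≤ {suc n} p (b ∷ S) min≡m i∈S with minOver (p ∘ suc) S in eq | i∈S
minOver-≤ p (true  ∷ S) refl _ | nothing | here      = ≤-refl
minOver-≤ p (true  ∷ S) refl _ | nothing | there i∈T with minOver-isJust (p ∘ suc) S i∈T
... | _ , eq′ with () ← trans (sym eq) eq′
minOver-≤ p (true  ∷ S) refl _ | just m′ | here      = p⊓q≤p (p zero) m′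
minOver-≤ p (true  ∷ S) refl _ | just m′ | there i∈T =
  ≤-trans (p⊓q≤q (p zero) m′) (minOver-≤ (p ∘ suc) S eq i∈T)
minOver-≤ p (false ∷ S) refl _ | just m′ | there i∈T = minOver-≤ (p ∘ suc) S eq i∈T

minOver-⊆ : (p : Prices n) {S T : Subset n} {i : Fin n} → T ⊆ S → i ∈ T →
  minOver p S ≡ just (p i) → minOver p T ≡ just (p i)
minOver-⊆ p {S} {T} T⊆S i∈T minS with minOver-isJust p T i∈T
... | m , minT with minOver-attained p T minT
...   | i′ , i′∈T , pi′≡m =
  trans minT (cong just (≤-antisym (minOver-≤ p T minT i∈T)
                                   (subst (p _ ≤_) pi′≡m (minOver-≤ p S minS (T⊆S i′∈T)))))

payIfAffordable-nonNeg : ∀ B x → 0ℚ ≤ x → 0ℚ ≤ payIfAffordable B x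
payIfAffordable-nonNeg B x 0≤x = go (x ≤? B)
  where
  go : (x≤?B : Dec (x ≤ B)) → 0ℚ ≤ (if does x≤?B then x else 0ℚ)
  go (yes _) = 0≤x
  go (no  _) = ≤-refl

payIfAffordable-≡ : ∀ {B x} → x ≤ B → payIfAffordable B x ≡ x
payIfAffordable-≡ {B} {x} x≤B = go (x ≤? B)
  where
  go : (x≤?B : Dec (x ≤ B)) → (if does x≤?B then x else 0ℚ) ≡ x
  go (yes _)   = refl
  go (no  x≰B) with () ← x≰B x≤B

payIfAffordable-≤ : ∀ B x {y} → (x ≤ B → x ≤ y) → 0ℚ ≤ y → payIfAffordable B x ≤ y
payIfAffordable-≤ B x {y} bound 0≤y = go (x ≤? B)
  where
  go : (x≤?B : Dec (x ≤ B)) → (if does x≤?B then x else 0ℚ) ≤ y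
  go (yes x≤B) = bound x≤B
  go (no  _)   = 0≤y

payment-nonNeg : ∀ rule (p : Prices n) → NonNegPrices p → ∀ c → 0ℚ ≤ payment rule p c
payment-nonNeg UDP p 0≤p c with minOver p (desired c) in eq
... | nothing = ≤-refl
... | just m with minOver-attained p (desired c) eq
...   | i , _ , pi≡m = payIfAffordable-nonNeg (budget c) m (subst (0ℚ ≤_) pi≡m (0≤p i))
payment-nonNeg SMP p 0≤p c = payIfAffordable-nonNeg (budget c) _ (sumOver-nonNeg p 0≤p (desired c))

payment-UDP-just : (p : Prices n) (c : Consumer n) {m : ℚ} → minOver p (desired c) ≡ just m →
  payment UDP p c ≡ payIfAffordable (budget c) m
payment-UDP-just p c min≡m with minOver p (desired c)
payment-UDP-just p c refl | just _ = refl

payment-UDP-≤-blocks : (p : Prices n) → NonNegPrices p → (part : Fin n → Fin q) → ∀ c →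
  payment UDP p c ≤ sumFin (λ j → payment UDP p (budget c , desired c ∩ block part j))
payment-UDP-≤-blocks p 0≤p part (B , S) with minOver p S in minS
... | nothing =
  sumFin-nonNeg (λ j → payment UDP p (B , S ∩ block part j)) (λ j → payment-nonNeg UDP p 0≤p _)
... | just _ with minOver-attained p S minS
...   | i , i∈S , refl =
  ≤-trans (≤-reflexive (sym (payment-UDP-just p (B , S ∩ block part (part i)) minSᵢ)))
          (≤-sumFin _ (λ j → payment-nonNeg UDP p 0≤p _) (part i))
  where
  minSᵢ : minOver p (S ∩ block part (part i)) ≡ just (p i)
  minSᵢ = minOver-⊆ p (p∩q⊆p S _) (x∈p∩q⁺ (i∈S , ∈-block part i)) minS

payment-SMP-≤-blocks : (p : Prices n) → NonNegPrices p → (part : Fin n → Fin q) → ∀ c →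
  payment SMP p c ≤ sumFin (λ j → payment SMP p (budget c , desired c ∩ block part j))
payment-SMP-≤-blocks {q = q} p 0≤p part (B , S) =
  payIfAffordable-≤ B (sumOver p S) affordable
    (sumFin-nonNeg paymentⱼ (λ j → payment-nonNeg SMP p 0≤p (B , S ∩ block part j)))
  where
  paymentⱼ : Fin q → ℚ
  paymentⱼ j = payment SMP p (B , S ∩ block part j)

  affordable : sumOver p S ≤ B → sumOver p S ≤ sumFin paymentⱼ
  affordable ΣS≤B = ≤-reflexive (trans (sumOver-partition p part S) (sumFin-cong _ _ (λ j →
    sym (payIfAffordable-≡ (≤-trans (sumOver-∩-≤ p 0≤p S (block part j)) ΣS≤B)))))

payment-≤-blocks : ∀ rule (p : Prices n) → NonNegPrices p → (part : Fin n → Fin q) → ∀ c →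
  payment rule p c ≤ sumFin (λ j → payment rule p (budget c , desired c ∩ block part j))
payment-≤-blocks UDP = payment-UDP-≤-blocks
payment-≤-blocks SMP = payment-SMP-≤-blocks

revenue-≤-blocks : ∀ rule (p : Prices n) → NonNegPrices p → (part : Fin n → Fin q) → ∀ C →
  revenue rule p C ≤ sumFin (λ j → revenue rule p (restrict part j C))
revenue-≤-blocks {q = q} rule p 0≤p part [] = ≤-reflexive (sym (sumFin-zero {q} _ (λ _ → refl)))
revenue-≤-blocks rule p 0≤p part (c ∷ C) =
  ≤-trans (+-mono-≤ (payment-≤-blocks rule p 0≤p part c) (revenue-≤-blocks rule p 0≤p part C))
          (≤-reflexive (sym (sumFin-+ (λ j → payment rule p (budget c , desired c ∩ block part j))
                                      (λ j → revenue rule p (restrict part j C)))))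

lemma7p4 : (rule : Rule) (q n : ℕ) → 1 ≤ℕ q →
    (C : List (Consumer n)) → All (λ c → 0ℚ ≤ budget c) C →
    (part : Fin n → Fin q) →
    (opt : ℚ) (optj : Fin q → ℚ) →
    IsOPT rule C opt →
    (∀ j → IsOPT rule (restrict part j C) (optj j)) →
    opt ≤ sumFin optj
lemma7p4 rule q n _ C _ part opt optj ((p , 0≤p , revenue≡opt) , _) optj-isOPT = begin
  opt                                                 ≡⟨ sym revenue≡opt ⟩
  revenue rule p C                                    ≤⟨ revenue-≤-blocks rule p 0≤p part C ⟩
  sumFin (λ j → revenue rule p (restrict part j C))   ≤⟨ sumFin-mono-≤ _ _ (λ j → proj₂ (optj-isOPT j) p 0≤p) ⟩
  sumFin optj                                         ∎
  where open ≤-Reasoning
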